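{- Let $\mathfrak A$ be a special extension of $\mathfrak E$, let $a,b$ be distinct diversity atoms of $\mathfrak E$, and let $u,v$ be diversity atoms of $\mathfrak C_{\mathfrak E}(\mathfrak A)$. If $u\le J(a,0)$ and $v\le J(b,0)$ then $u;v=J(a;b,0)$. In particular, if $a;b=0'$ then $u;v=0'$ (the diversity element of $\mathfrak C_{\mathfrak E}(\mathfrak A)$).
   Context: Relation algebras are symmetric ($\breve x=x$) and integral ($1'$ an atom); $0'=\overline{1'}$. If $\mathfrak A,\mathfrak E$ are finite symmetric integral relation algebras, $\mathfrak A$ is a special extension of $\mathfrak E$ if $\mathfrak E\subseteq\mathfrak A$ and for all diversity atoms $a,b,c$ of $\mathfrak E$: (1) if not $a=b=c$ and $a;b\ge c$, then $x;y\ge c$ for all atoms $x\le a$, $y\le b$ of $\mathfrak A$; (2) if $a;a\ge a$, then $x;y\cdot a\ne0$ for all atoms $x,y\le a$ of $\mathfrak A$. For each atom $x$ of $\mathfrak A$ let $c(x)$ be the atom of $\mathfrak E$ with $x\le c(x)$. $T(i,j,k)$ iff $(i\le j=k)$ or $(j\le k=i)$ or $(k\le i=j)$. $\mathrm{At}=\{1'\}\cup\{x^{(i)}: x\text{ diversity atom of }\mathfrak A,\ i\in\omega\}$. $Cy\subseteq\mathrm{At}^3$ consists of all permutations of $(1',1',1')$, of $(1',x^{(i)},x^{(i)})$, and of $(x^{(i)},y^{(j)},z^{(k)})$ whenever $x,y,z$ are diversity atoms of $\mathfrak A$ with $x;y\ge z$ and ($c(x)=c(y)=c(z)\Rightarrow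 T(i,j,k)$). $\mathfrak C_{\mathfrak E}(\mathfrak A)$ is the complex algebra on the power set of $\mathrm{At}$ with Boolean set operations, identity $\{1'\}$, identity converse, and $X;Y=\{w:\exists u\in X,v\in Y,(u,v,w)\in Cy\}$; atoms are identified with singletons. $J(a,n)=\{x^{(i)}: x\text{ diversity atom of }\mathfrak A,\ x\le a,\ n\le i\}\cup\{1':1'\le a\}$ for $a\in\mathfrak A$, $n\in\omega$. -}

module Defs where

open import Level using (0ℓ)
open import Data.Nat using (ℕ) renaming (_≤_ to _≤ℕ_)
open import Data.Product using (Σ; ∃; _×_; _,_)
open import Data.Sum using (_⊎_)
open import Data.List using (List)
open import Data.List.Relation.Unary.Any using (Any)
open import Relation.Nullary using (¬_)
open import Relation.Binary.PropositionalEquality using (_≡_)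
open import Algebra.Lattice.Structures using (IsBooleanAlgebra)

-- Symmetric relation algebras (converse is the identity map).
-- Tarski's axioms R1-R10 with x˘ = x become: a Boolean algebra,
-- ; associative, ; distributes over + (on the right), x;1' = x,
-- (x;y)˘ = y˘;x˘ becomes commutativity of ;, and
-- R10: x˘;-(x;y) ≤ -y becomes  x;-(x;y) ≤ -y.

record SymRA : Set₁ where
  infix  8 -_
  infixr 7 _·_
  infixr 6 _+_
  infixr 7 _⨾_
  infix  4 _≈_ _≤_
  field
    Carrier : Set
    _≈_     : Carrier → Carrier → Set
    _+_     : Carrier → Carrier → Carrier
    _·_     : Carrier → Carrier → Carrier
    -_      : Carrier → Carrier
    𝟏       : Carrier
    𝟎       : Carrier
    isBooleanAlgebra : IsBooleanAlgebra _≈_ _+_ _·_ -_ 𝟏 𝟎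
    _⨾_     : Carrier → Carrier → Carrier
    1'      : Carrier
    ⨾-cong    : ∀ {x x' y y'} → x ≈ x' → y ≈ y' → (x ⨾ y) ≈ (x' ⨾ y')
    ⨾-assoc   : ∀ x y z → ((x ⨾ y) ⨾ z) ≈ (x ⨾ (y ⨾ z))
    ⨾-distrib : ∀ x y z → ((x + y) ⨾ z) ≈ ((x ⨾ z) + (y ⨾ z))
    ⨾-identity : ∀ x → (x ⨾ 1') ≈ x
    ⨾-comm    : ∀ x y → (x ⨾ y) ≈ (y ⨾ x)
    tarski    : ∀ x y → ((x ⨾ (- (x ⨾ y))) + (- y)) ≈ (- y)

  _≤_ : Carrier → Carrier → Set
  x ≤ y = (x + y) ≈ y

  0' : Carrier
  0' = - 1'

  Atom : Carrier → Set
  Atom x = (¬ (x ≈ 𝟎)) × (∀ y → y ≤ x → (y ≈ 𝟎) ⊎ (y ≈ x))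

  DivAtom : Carrier → Set
  DivAtom x = Atom x × (x ≤ 0')

  Integral : Set
  Integral = Atom 1'

  Finite : Set
  Finite = Σ (List Carrier) λ xs → ∀ x → Any (λ y → x ≈ y) xs

record FSIRA : Set₁ where
  field
    ra       : SymRA
  open SymRA ra public
  field
    finite   : Finite
    integral : Integral

record Subalgebra (A : FSIRA) : Set₁ where
  open FSIRA A
  field
    In      : Carrier → Set
    In-resp : ∀ {x y} → x ≈ y → In x → In y
    In-+    : ∀ {x y} → In x → In y → In (x + y)
    In-·    : ∀ {x y} → In x → In y → In (x · y)
    In--    : ∀ {x} → In x → In (- x)
    In-𝟏    : In 𝟏
    In-𝟎    : In 𝟎
    In-⨾    : ∀ {x y} → In x → In y → In (x ⨾ y)
    In-1'   : In 1'

  EAtom : Carrier → Set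
  EAtom e = In e × (¬ (e ≈ 𝟎)) × (∀ y → In y → y ≤ e → (y ≈ 𝟎) ⊎ (y ≈ e))

  EDivAtom : Carrier → Set
  EDivAtom e = EAtom e × (e ≤ 0')

  -- c(x) = c(y) = c(z): the 𝔈-atoms above x, y, z coincide
  SameC : Carrier → Carrier → Carrier → Set
  SameC x y z = ∃ λ e → EAtom e × (x ≤ e) × (y ≤ e) × (z ≤ e)

record Special (A : FSIRA) (E : Subalgebra A) : Set where
  open FSIRA A
  open Subalgebra E
  field
    cond1 : ∀ a b c → EDivAtom a → EDivAtom b → EDivAtom c →
            ¬ ((a ≈ b) × (b ≈ c)) → c ≤ (a ⨾ b) →
            ∀ x y → Atom x → x ≤ a → Atom y → y ≤ b → c ≤ (x ⨾ y)
    cond2 : ∀ a → EDivAtom a → a ≤ (a ⨾ a) →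
            ∀ x y → Atom x → x ≤ a → Atom y → y ≤ a →
            ¬ (((x ⨾ y) · a) ≈ 𝟎)

T : ℕ → ℕ → ℕ → Set
T i j k = ((i ≤ℕ j) × (j ≡ k)) ⊎ (((j ≤ℕ k) × (k ≡ i)) ⊎ ((k ≤ℕ i) × (i ≡ j)))

module C (A : FSIRA) (E : Subalgebra A) where
  open FSIRA A
  open Subalgebra E

  data At : Set where
    one : At
    at  : (x : Carrier) → DivAtom x → ℕ → At

  data _≈At_ : At → At → Set where
    one≈ : one ≈At one
    at≈  : ∀ {x p i y q j} → x ≈ y → i ≡ j → at x p i ≈At at y q j

  data Cy : At → At → At → Set where
    c111 : Cy one one one
    c1xx : ∀ {x p i y q j} → x ≈ y → i ≡ j → Cy one (at x p i) (at y q j)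
    cx1x : ∀ {x p i y q j} → x ≈ y → i ≡ j → Cy (at x p i) one (at y q j)
    cxx1 : ∀ {x p i y q j} → x ≈ y → i ≡ j → Cy (at x p i) (at y q j) one
    cxyz : ∀ {x p i y q j z r k} → z ≤ (x ⨾ y) → (SameC x y z → T i j k) →
           Cy (at x p i) (at y q j) (at z r k)

  Elt : Set₁
  Elt = At → Set

  _⊆_ : Elt → Elt → Set
  X ⊆ Y = ∀ w → X w → Y w

  _≐_ : Elt → Elt → Set
  X ≐ Y = (X ⊆ Y) × (Y ⊆ X)

  _⊙_ : Elt → Elt → Elt
  (X ⊙ Y) w = ∃ λ u → ∃ λ v → X u × Y v × Cy u v w

  ⟦_⟧ : At → Elt
  ⟦ w ⟧ w' = w ≈At w'

  Div : Elt
  Div w = ¬ (⟦ one ⟧ w)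

  J : Carrier → ℕ → Elt
  J a n one        = 1' ≤ a
  J a n (at x _ i) = (x ≤ a) × (n ≤ℕ i)

-- For atoms x ≤ a and y ≤ b of 𝔄, every cycle (x^(i), y^(j), w) has w = z^(k) with
-- z ≤ x;y ≤ a;b: w = 1' would force x = y ≤ a·b = 0.  Conversely, let z ≤ a;b be a
-- diversity atom and e = c(z).  Then e ≤ a;b, so condition (1) of a special extension
-- gives e ≤ x;y and hence z ≤ x;y.  The index condition T never applies, because
-- c(x) = a ≠ b = c(y), so (x^(i), y^(j), z^(k)) is a cycle for every k.  Finally
-- J(0',0) is the diversity element because 1' ≰ 0'.

module Submission where

open import Defs
open import Level using (0ℓ)
open import Function using (_∘_)
open import Data.Nat using (z≤n)
open import Data.Product using (_×_; _,_; proj₁; proj₂; ∃)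
open import Data.Sum using (_⊎_; inj₁; inj₂)
open import Data.Empty using (⊥-elim)
open import Data.List using (List; []; _∷_)
open import Data.List.Relation.Unary.All using (All; []; _∷_; universal; sequenceM)
open import Data.List.Relation.Unary.Any using (Any; here; there)
open import Relation.Nullary using (¬_; Dec; yes; no)
open import Relation.Nullary.Negation using (¬¬-Monad)
open import Relation.Nullary.Decidable using (¬¬-excluded-middle)
open import Relation.Binary using (Rel)
import Relation.Binary.PropositionalEquality as ≡
open import Algebra.Lattice.Bundles using (BooleanAlgebra)
import Algebra.Lattice.Properties.Lattice as LatticeProperties
import Algebra.Lattice.Properties.BooleanAlgebra as BooleanAlgebraProperties
import Relation.Binary.Lattice as OrderTheoretic
import Relation.Binary.Reasoning.Setoid as SetoidReasoning

module BooleanOrder {c ℓ} (B : BooleanAlgebra c ℓ) where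
  open BooleanAlgebra B renaming (¬_ to ∁_)
  open BooleanAlgebraProperties B using (∨-identityʳ; ∨-identityˡ; ∨-zeroʳ; ∧-identityʳ)
  open LatticeProperties lattice using (∨-∧-orderTheoreticLattice)
  open SetoidReasoning setoid
  private
    module O = OrderTheoretic.Lattice ∨-∧-orderTheoreticLattice

  infix 4 _≤_
  _≤_ : Rel Carrier ℓ
  x ≤ y = x ∨ y ≈ y

  -- The library's order-theoretic lattice uses the meet order x ≈ x ∧ y.
  ≤⇒≤∧ : ∀ {x y} → x ≤ y → x O.≤ y
  ≤⇒≤∧ {x} {y} x∨y≈y = sym (begin
    x ∧ y        ≈⟨ ∧-cong refl (sym x∨y≈y) ⟩
    x ∧ (x ∨ y)  ≈⟨ ∧-absorbs-∨ x y ⟩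
    x            ∎)

  ≤∧⇒≤ : ∀ {x y} → x O.≤ y → x ≤ y
  ≤∧⇒≤ {x} {y} x≈x∧y = begin
    x ∨ y        ≈⟨ ∨-cong x≈x∧y refl ⟩
    (x ∧ y) ∨ y  ≈⟨ ∨-comm _ _ ⟩
    y ∨ (x ∧ y)  ≈⟨ ∨-cong refl (∧-comm x y) ⟩
    y ∨ (y ∧ x)  ≈⟨ ∨-absorbs-∧ y x ⟩
    y            ∎

  ≤-refl : ∀ {x} → x ≤ x
  ≤-refl = ≤∧⇒≤ O.refl

  ≤-reflexive : ∀ {x y} → x ≈ y → x ≤ y
  ≤-reflexive x≈y = ≤∧⇒≤ (O.reflexive x≈y)

  ≤-trans : ∀ {x y z} → x ≤ y → y ≤ z → x ≤ z
  ≤-trans x≤y y≤z = ≤∧⇒≤ (O.trans (≤⇒≤∧ x≤y) (≤⇒≤∧ y≤z))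

  ≤-antisym : ∀ {x y} → x ≤ y → y ≤ x → x ≈ y
  ≤-antisym x≤y y≤x = O.antisym (≤⇒≤∧ x≤y) (≤⇒≤∧ y≤x)

  x∧y≤x : ∀ x y → x ∧ y ≤ x
  x∧y≤x x y = ≤∧⇒≤ (O.x∧y≤x x y)

  x∧y≤y : ∀ x y → x ∧ y ≤ y
  x∧y≤y x y = ≤∧⇒≤ (O.x∧y≤y x y)

  ∧-greatest : ∀ {x y z} → x ≤ y → x ≤ z → x ≤ y ∧ z
  ∧-greatest x≤y x≤z = ≤∧⇒≤ (O.∧-greatest (≤⇒≤∧ x≤y) (≤⇒≤∧ x≤z))

  x∧y≈x⇒x≤y : ∀ {x y} → x ∧ y ≈ x → x ≤ y
  x∧y≈x⇒x≤y x∧y≈x = ≤∧⇒≤ (sym x∧y≈x)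

  x≤⊤ : ∀ x → x ≤ ⊤
  x≤⊤ = ∨-zeroʳ

  x≤⊥⇒x≈⊥ : ∀ {x} → x ≤ ⊥ → x ≈ ⊥
  x≤⊥⇒x≈⊥ {x} x∨⊥≈⊥ = trans (sym (∨-identityʳ x)) x∨⊥≈⊥

  ≤-disjoint⇒≈⊥ : ∀ {x y z} → x ≤ y → x ≤ z → y ∧ z ≈ ⊥ → x ≈ ⊥
  ≤-disjoint⇒≈⊥ x≤y x≤z y∧z≈⊥ = x≤⊥⇒x≈⊥ (≤-trans (∧-greatest x≤y x≤z) (≤-reflexive y∧z≈⊥))

  x∧y≈⊥⇒x≤∁y : ∀ {x y} → x ∧ y ≈ ⊥ → x ≤ ∁ y
  x∧y≈⊥⇒x≤∁y {x} {y} x∧y≈⊥ = ≤∧⇒≤ (begin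
    x                      ≈⟨ sym (∧-identityʳ x) ⟩
    x ∧ ⊤                  ≈⟨ ∧-cong refl (sym (∨-complementʳ y)) ⟩
    x ∧ (y ∨ ∁ y)          ≈⟨ ∧-distribˡ-∨ x y (∁ y) ⟩
    (x ∧ y) ∨ (x ∧ ∁ y)    ≈⟨ ∨-cong x∧y≈⊥ refl ⟩
    ⊥ ∨ (x ∧ ∁ y)          ≈⟨ ∨-identityˡ _ ⟩
    x ∧ ∁ y                ∎)

module RelationAlgebraProperties (R : SymRA) where
  open SymRA R

  booleanAlgebra : BooleanAlgebra 0ℓ 0ℓ
  booleanAlgebra = record { isBooleanAlgebra = isBooleanAlgebra }

  open BooleanAlgebra booleanAlgebra public using (refl; sym; trans; ∧-comm; ∧-complementʳ; ¬-cong)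
  open BooleanOrder booleanAlgebra public hiding (_≤_)
  open SetoidReasoning (BooleanAlgebra.setoid booleanAlgebra)

  ⨾-monoˡ : ∀ {x x'} y → x ≤ x' → x ⨾ y ≤ x' ⨾ y
  ⨾-monoˡ {x} {x'} y x≤x' = begin
    (x ⨾ y) + (x' ⨾ y)  ≈⟨ sym (⨾-distrib x x' y) ⟩
    (x + x') ⨾ y        ≈⟨ ⨾-cong x≤x' refl ⟩
    x' ⨾ y              ∎

  ⨾-monoʳ : ∀ x {y y'} → y ≤ y' → x ⨾ y ≤ x ⨾ y'
  ⨾-monoʳ x {y} {y'} y≤y' =
    ≤-trans (≤-reflexive (⨾-comm x y)) (≤-trans (⨾-monoˡ x y≤y') (≤-reflexive (⨾-comm y' x)))

  ⨾-mono : ∀ {x x' y y'} → x ≤ x' → y ≤ y' → x ⨾ y ≤ x' ⨾ y'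
  ⨾-mono {x' = x'} {y = y} x≤x' y≤y' = ≤-trans (⨾-monoˡ y x≤x') (⨾-monoʳ x' y≤y')

  x⨾-x≤0' : ∀ x → x ⨾ (- x) ≤ 0'
  x⨾-x≤0' x = ≤-trans (⨾-monoʳ x (≤-reflexive (¬-cong (sym (⨾-identity x))))) (tarski x 1')

  disjoint⇒⨾≤0' : ∀ {a b} → a · b ≈ 𝟎 → a ⨾ b ≤ 0'
  disjoint⇒⨾≤0' {a} {b} a·b≈𝟎 = ≤-trans (⨾-monoʳ a (x∧y≈⊥⇒x≤∁y b·a≈𝟎)) (x⨾-x≤0' a)
    where
      b·a≈𝟎 : b · a ≈ 𝟎
      b·a≈𝟎 = trans (∧-comm _ _) a·b≈𝟎

  atom-dichotomy : ∀ {z} → Atom z → ∀ w → z · w ≈ 𝟎 ⊎ z ≤ w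
  atom-dichotomy {z} (_ , below) w with below (z · w) (x∧y≤x z w)
  ... | inj₁ z·w≈𝟎 = inj₁ z·w≈𝟎
  ... | inj₂ z·w≈z = inj₂ (x∧y≈x⇒x≤y z·w≈z)

module SubalgebraAtoms (A : FSIRA) (E : Subalgebra A) where
  open FSIRA A
  open Subalgebra E
  open RelationAlgebraProperties ra

  meets⇒EAtom≤ : ∀ {e w x} → EAtom e → In w → ¬ x ≈ 𝟎 → x ≤ e → x ≤ w → e ≤ w
  meets⇒EAtom≤ {e} {w} (e∈E , _ , below) w∈E x≉𝟎 x≤e x≤w
    with below (e · w) (In-· e∈E w∈E) (x∧y≤x e w)
  ... | inj₁ e·w≈𝟎 = ⊥-elim (x≉𝟎 (≤-disjoint⇒≈⊥ x≤e x≤w e·w≈𝟎))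
  ... | inj₂ e·w≈e = x∧y≈x⇒x≤y e·w≈e

  EAtom-disjoint : ∀ {a b} → EAtom a → EAtom b → ¬ a ≈ b → a · b ≈ 𝟎
  EAtom-disjoint {a} {b} (a∈E , a≉𝟎 , below) eb@(b∈E , _ , _) a≉b
    with below (a · b) (In-· a∈E b∈E) (x∧y≤x a b)
  ... | inj₁ a·b≈𝟎 = a·b≈𝟎
  ... | inj₂ a·b≈a = ⊥-elim (a≉b (≤-antisym a≤b (meets⇒EAtom≤ eb a∈E a≉𝟎 a≤b ≤-refl)))
    where
      a≤b : a ≤ b
      a≤b = x∧y≈x⇒x≤y a·b≈a

  LeastAbove : Carrier → List Carrier → Carrier → Set
  LeastAbove z ws c = In c × z ≤ c × (∀ {w} → In w → z ≤ w → Any (w ≈_) ws → c ≤ w)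

  leastAbove-∷ : ∀ {z w ws c c'} → LeastAbove z ws c → In c' → z ≤ c' → c' ≤ c →
                 (∀ {v} → In v → z ≤ v → v ≈ w → c' ≤ v) → LeastAbove z (w ∷ ws) c'
  leastAbove-∷ (_ , _ , least) c'∈E z≤c' c'≤c head = c'∈E , z≤c' , λ where
    v∈E z≤v (here v≈w)   → head v∈E z≤v v≈w
    v∈E z≤v (there v∈ws) → ≤-trans c'≤c (least v∈E z≤v v∈ws)

  leastAbove : ∀ {z} → Atom z → (ws : List Carrier) → All (Dec ∘ In) ws → ∃ (LeastAbove z ws)
  leastAbove az [] [] = 𝟏 , In-𝟏 , x≤⊤ _ , λ _ _ ()
  leastAbove az (w ∷ ws) (w∈E? ∷ ws∈E?) with leastAbove az ws ws∈E?
  ... | c , la@(c∈E , z≤c , _) with w∈E? | atom-dichotomy az w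
  ... | yes w∈E | inj₂ z≤w =
    w · c , leastAbove-∷ la (In-· w∈E c∈E) (∧-greatest z≤w z≤c) (x∧y≤y w c)
              (λ _ _ v≈w → ≤-trans (x∧y≤x w c) (≤-reflexive (sym v≈w)))
  ... | yes _ | inj₁ z·w≈𝟎 =
    c , leastAbove-∷ la c∈E z≤c ≤-refl
          (λ _ z≤v v≈w → ⊥-elim (proj₁ az
            (≤-disjoint⇒≈⊥ ≤-refl (≤-trans z≤v (≤-reflexive v≈w)) z·w≈𝟎)))
  ... | no w∉E | _ =
    c , leastAbove-∷ la c∈E z≤c ≤-refl (λ v∈E _ v≈w → ⊥-elim (w∉E (In-resp v≈w v∈E)))

  leastAbove⇒EAtom : ∀ {z c} → Atom z → LeastAbove z (proj₁ finite) c → EAtom c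
  leastAbove⇒EAtom {c = c} az (c∈E , z≤c , least) = c∈E , c≉𝟎 , below
    where
      c≉𝟎 : ¬ c ≈ 𝟎
      c≉𝟎 c≈𝟎 = proj₁ az (x≤⊥⇒x≈⊥ (≤-trans z≤c (≤-reflexive c≈𝟎)))
      below : ∀ w → In w → w ≤ c → w ≈ 𝟎 ⊎ w ≈ c
      below w w∈E w≤c with atom-dichotomy az w
      ... | inj₂ z≤w = inj₂ (≤-antisym w≤c (least w∈E z≤w (proj₂ finite w)))
      ... | inj₁ z·w≈𝟎 = inj₁ (≤-disjoint⇒≈⊥ ≤-refl w≤-w (∧-complementʳ w))
        where
          w≤-w : w ≤ - w
          w≤-w = ≤-trans w≤c (least (In-- w∈E) (x∧y≈⊥⇒x≤∁y z·w≈𝟎) (proj₂ finite (- w)))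

  -- c(z) is the meet of all elements of 𝔈 above z.  Membership in 𝔈 is not decidable,
  -- but deciding it for the finitely many elements of 𝔄 is harmless under ¬ ¬.
  EAtom-above : ∀ {z} → Atom z → ¬ ¬ ∃ λ e → EAtom e × z ≤ e
  EAtom-above az ¬above = decideAll λ decisions →
    let c , la = leastAbove az (proj₁ finite) decisions
    in ¬above (c , leastAbove⇒EAtom az la , proj₁ (proj₂ la))
    where
      decideAll : ¬ ¬ All (Dec ∘ In) (proj₁ finite)
      decideAll = sequenceM 0ℓ ¬¬-Monad (universal (λ _ → ¬¬-excluded-middle) (proj₁ finite))

module SpecialExtension (A : FSIRA) (E : Subalgebra A) (S : Special A E) where
  open FSIRA A
  open Subalgebra E
  open Special S
  open RelationAlgebraProperties ra
  open SubalgebraAtoms A E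

  ≤a⨾b⇒≤x⨾y : ∀ {a b x y z} → EDivAtom a → EDivAtom b → ¬ a ≈ b →
              Atom x → x ≤ a → Atom y → y ≤ b → Atom z → z ≤ a ⨾ b → z ≤ x ⨾ y
  ≤a⨾b⇒≤x⨾y {a} {b} {x} {y} {z} ea eb a≉b ax x≤a ay y≤b az z≤a⨾b
    with atom-dichotomy az (x ⨾ y)
  ... | inj₂ z≤x⨾y = z≤x⨾y
  ... | inj₁ z·x⨾y≈𝟎 = ⊥-elim (EAtom-above az λ (e , ee , z≤e) →
          proj₁ az (≤-disjoint⇒≈⊥ ≤-refl (≤-trans z≤e (e≤x⨾y ee z≤e)) z·x⨾y≈𝟎))
    where
      e≤x⨾y : ∀ {e} → EAtom e → z ≤ e → e ≤ x ⨾ y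
      e≤x⨾y {e} ee z≤e = cond1 a b e ea eb (ee , e≤0') (a≉b ∘ proj₁) e≤a⨾b x y ax x≤a ay y≤b
        where
          e≤a⨾b : e ≤ a ⨾ b
          e≤a⨾b = meets⇒EAtom≤ ee (In-⨾ (proj₁ (proj₁ ea)) (proj₁ (proj₁ eb))) (proj₁ az) z≤e z≤a⨾b
          e≤0' : e ≤ 0'
          e≤0' = ≤-trans e≤a⨾b (disjoint⇒⨾≤0' (EAtom-disjoint (proj₁ ea) (proj₁ eb) a≉b))

  distinct⇒¬SameC : ∀ {a b x y z} → EAtom a → EAtom b → ¬ a ≈ b →
                    Atom x → x ≤ a → Atom y → y ≤ b → ¬ SameC x y z
  distinct⇒¬SameC ea eb a≉b ax x≤a ay y≤b (e , ee@(_ , e≉𝟎 , _) , x≤e , y≤e , _) =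
    e≉𝟎 (≤-disjoint⇒≈⊥ (meets⇒EAtom≤ ee (proj₁ ea) (proj₁ ax) x≤e x≤a)
                        (meets⇒EAtom≤ ee (proj₁ eb) (proj₁ ay) y≤e y≤b)
                        (EAtom-disjoint ea eb a≉b))

module ComplexAlgebraComposition (A : FSIRA) (E : Subalgebra A) (S : Special A E) where
  open FSIRA A
  open Subalgebra E
  open C A E
  open RelationAlgebraProperties ra
  open SubalgebraAtoms A E
  open SpecialExtension A E S

  ≐-trans : ∀ {X Y Z} → X ≐ Y → Y ≐ Z → X ≐ Z
  ≐-trans (X⊆Y , Y⊆X) (Y⊆Z , Z⊆Y) = (λ w → Y⊆Z w ∘ X⊆Y w) , (λ w → Y⊆X w ∘ Z⊆Y w)

  J-resp-≈ : ∀ {a a' n} → a ≈ a' → J a n ⊆ J a' n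
  J-resp-≈ a≈a' one 1'≤a = ≤-trans 1'≤a (≤-reflexive a≈a')
  J-resp-≈ a≈a' (at x _ _) (x≤a , n≤i) = ≤-trans x≤a (≤-reflexive a≈a') , n≤i

  1'≰0' : ¬ 1' ≤ 0'
  1'≰0' 1'≤0' = proj₁ integral (≤-disjoint⇒≈⊥ ≤-refl 1'≤0' (∧-complementʳ 1'))

  J0'≐Div : J 0' 0 ≐ Div
  J0'≐Div = J⊆Div , Div⊆J
    where
      J⊆Div : J 0' 0 ⊆ Div
      J⊆Div one 1'≤0' _ = 1'≰0' 1'≤0'
      J⊆Div (at _ _ _) _ ()
      Div⊆J : Div ⊆ J 0' 0
      Div⊆J one ¬1'≈1' = ⊥-elim (¬1'≈1' one≈)
      Div⊆J (at _ p _) _ = proj₂ p , z≤n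

  at⊙at⊆J : ∀ {a b x y p q i j} → a · b ≈ 𝟎 → x ≤ a → y ≤ b →
            (⟦ at x p i ⟧ ⊙ ⟦ at y q j ⟧) ⊆ J (a ⨾ b) 0
  at⊙at⊆J {b = b} {x} {p = p} a·b≈𝟎 x≤a y≤b .one
          (_ , _ , at≈ x≈x' ≡.refl , at≈ y≈y' ≡.refl , cxx1 x'≈y' ≡.refl) =
    ⊥-elim (proj₁ (proj₁ p) (≤-disjoint⇒≈⊥ x≤a x≤b a·b≈𝟎))
    where
      x≤b : x ≤ b
      x≤b = ≤-trans (≤-reflexive (trans x≈x' (trans x'≈y' (sym y≈y')))) y≤b
  at⊙at⊆J a·b≈𝟎 x≤a y≤b .(at _ _ _)
          (_ , _ , at≈ x≈x' ≡.refl , at≈ y≈y' ≡.refl , cxyz z≤x'⨾y' _) =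
    ≤-trans z≤x'⨾y' (⨾-mono (≤-trans (≤-reflexive (sym x≈x')) x≤a)
                            (≤-trans (≤-reflexive (sym y≈y')) y≤b)) , z≤n

  J⊆at⊙at : ∀ {a b x y p q i j} → EDivAtom a → EDivAtom b → ¬ a ≈ b → x ≤ a → y ≤ b →
            J (a ⨾ b) 0 ⊆ (⟦ at x p i ⟧ ⊙ ⟦ at y q j ⟧)
  J⊆at⊙at ea eb a≉b x≤a y≤b one 1'≤a⨾b =
    ⊥-elim (1'≰0' (≤-trans 1'≤a⨾b (disjoint⇒⨾≤0' (EAtom-disjoint (proj₁ ea) (proj₁ eb) a≉b))))
  J⊆at⊙at {x = x} {y} {p} {q} {i} {j} ea eb a≉b x≤a y≤b (at _ r _) (z≤a⨾b , _) =
    at x p i , at y q j , at≈ refl ≡.refl , at≈ refl ≡.refl ,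
    cxyz (≤a⨾b⇒≤x⨾y ea eb a≉b (proj₁ p) x≤a (proj₁ q) y≤b (proj₁ r) z≤a⨾b)
         (⊥-elim ∘ distinct⇒¬SameC (proj₁ ea) (proj₁ eb) a≉b (proj₁ p) x≤a (proj₁ q) y≤b)

  at⊙at≐J : ∀ {a b x y p q i j} → EDivAtom a → EDivAtom b → ¬ a ≈ b → x ≤ a → y ≤ b →
            (⟦ at x p i ⟧ ⊙ ⟦ at y q j ⟧) ≐ J (a ⨾ b) 0
  at⊙at≐J ea eb a≉b x≤a y≤b =
    at⊙at⊆J (EAtom-disjoint (proj₁ ea) (proj₁ eb) a≉b) x≤a y≤b , J⊆at⊙at ea eb a≉b x≤a y≤b

lemma3 : (A : FSIRA) (E : Subalgebra A) → Special A E →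
    let open FSIRA A
        open Subalgebra E
        open C A E
    in ∀ a b → EDivAtom a → EDivAtom b → ¬ (a ≈ b) →
       ∀ u v → ¬ (u ≈At one) → ¬ (v ≈At one) →
       ⟦ u ⟧ ⊆ J a 0 → ⟦ v ⟧ ⊆ J b 0 →
       ((⟦ u ⟧ ⊙ ⟦ v ⟧) ≐ J (a ⨾ b) 0)
       × ((a ⨾ b) ≈ 0' → (⟦ u ⟧ ⊙ ⟦ v ⟧) ≐ Div)
lemma3 A E S a b ea eb a≉b C.one _ u≉1' _ _ _ = ⊥-elim (u≉1' C.one≈)
lemma3 A E S a b ea eb a≉b (C.at _ _ _) C.one _ v≉1' _ _ = ⊥-elim (v≉1' C.one≈)
lemma3 A E S a b ea eb a≉b u@(C.at _ _ _) v@(C.at _ _ _) _ _ u≤J v≤J =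
  uv≐J , λ a⨾b≈0' → ≐-trans uv≐J (≐-trans (J-resp-≈ a⨾b≈0' , J-resp-≈ (sym a⨾b≈0')) J0'≐Div)
  where
    open FSIRA A using (ra; _⨾_)
    open C A E using (⟦_⟧; _⊙_; _≐_; J; at≈)
    open RelationAlgebraProperties ra using (refl; sym)
    open ComplexAlgebraComposition A E S
    uv≐J : (⟦ u ⟧ ⊙ ⟦ v ⟧) ≐ J (a ⨾ b) 0
    uv≐J = at⊙at≐J ea eb a≉b (proj₁ (u≤J u (at≈ refl ≡.refl))) (proj₁ (v≤J v (at≈ refl ≡.refl)))
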